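{- Let $4\le n\le 6$. For each integer $t$ with $0\le t\le n-4$ and $t\equiv \frac12 n(n-5)\pmod 2$, except when $(n,t)=(5,0)$, there exists a nonorientable quadrangular embedding of a simple graph with $n$ vertices and $\binom{n}{2}-t$ edges. There also exists a quadrangular embedding in the Klein bottle $N_2$ of a simple graph with $6$ vertices and $\binom{6}{2}-3=12$ edges.
   Context: All graphs are simple. Embeddings are cellular embeddings in surfaces (connected compact 2-manifolds without boundary), i.e., every face is an open disc. An embedding is quadrangular if every face is bounded by a $4$-cycle; it is nonorientable if the surface is nonorientable. $N_2$ denotes the nonorientable surface of genus $2$ (Klein bottle). -}

module Defs where

open import Data.Bool using (Bool; true; false; if_then_else_; _∧_)
open import Data.Nat using (ℕ; zero; suc; _+_; _<ᵇ_)
open import Data.Fin using (Fin; toℕ; _≟_)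
open import Data.List using (List; []; _∷_; length; filter; map; allFin; lookup; tabulate)
open import Data.Nat.ListAction using (sum)
open import Data.List.Membership.Propositional using (_∈_)
open import Data.Product using (Σ; _×_; _,_; ∃; ∃-syntax)
open import Data.Product.Properties using (≡-dec)
open import Data.Sum using (_⊎_)
open import Relation.Binary.PropositionalEquality using (_≡_)
open import Relation.Binary.Construct.Closure.ReflexiveTransitive using (Star)
open import Relation.Nullary using (¬_)

record SimpleGraph (n : ℕ) : Set where
  field
    adj   : Fin n → Fin n → Bool
    sym   : ∀ u v → adj u v ≡ adj v u
    loopless : ∀ v → adj v v ≡ false
open SimpleGraph public

Adj : ∀ {n} → SimpleGraph n → Fin n → Fin n → Set
Adj G u v = adj G u v ≡ true

edgeCount : ∀ {n} → SimpleGraph n → ℕ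
edgeCount {n} G =
  sum (map (λ i → sum (map (λ j → if (toℕ i <ᵇ toℕ j) ∧ adj G i j then 1 else 0)
                              (allFin n)))
           (allFin n))

Connected : ∀ {n} → SimpleGraph n → Set
Connected G = ∀ u v → Star (Adj G) u v

-- A (boundary walk of a) quadrangular face: (a , b , c , d) with boundary a-b-c-d-a.
Quad : ℕ → Set
Quad n = Fin n × Fin n × Fin n × Fin n

Is4Cycle : ∀ {n} → SimpleGraph n → Quad n → Set
Is4Cycle G (a , b , c , d) =
  (¬ a ≡ b) × (¬ a ≡ c) × (¬ a ≡ d) × (¬ b ≡ c) × (¬ b ≡ d) × (¬ c ≡ d) ×
  Adj G a b × Adj G b c × Adj G c d × Adj G d a

dirEdges : ∀ {n} → Quad n → List (Fin n × Fin n)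
dirEdges (a , b , c , d) = (a , b) ∷ (b , c) ∷ (c , d) ∷ (d , a) ∷ []

corners : ∀ {n} → Quad n → List (Fin n × Fin n × Fin n)
corners (a , b , c , d) = (d , a , b) ∷ (a , b , c) ∷ (b , c , d) ∷ (c , d , a) ∷ []

reverseQuad : ∀ {n} → Quad n → Quad n
reverseQuad (a , b , c , d) = (d , c , b , a)

_≟₂_ : ∀ {n} → (p q : Fin n × Fin n) → Relation.Nullary.Dec (p ≡ q)
_≟₂_ = ≡-dec _≟_ _≟_

dirCount : ∀ {n} → List (Quad n) → Fin n → Fin n → ℕ
dirCount fs u v = sum (map (λ f → length (filter (λ e → e ≟₂ (u , v)) (dirEdges f))) fs)

edgeOcc : ∀ {n} → List (Quad n) → Fin n → Fin n → ℕ
edgeOcc fs u v = dirCount fs u v + dirCount fs v u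

-- link of vertex v: two neighbours x , y are joined when some face has a corner x-v-y
LinkEdge : ∀ {n} → List (Quad n) → Fin n → Fin n → Fin n → Set
LinkEdge fs v x y = ∃[ f ] (f ∈ fs × ((x , v , y) ∈ corners f ⊎ (y , v , x) ∈ corners f))

-- A cellular quadrangular embedding of G in a closed surface, given combinatorially
-- by its list of faces (each bounded by a 4-cycle of G) glued along edges:
-- every edge lies on exactly two face sides, the graph is connected, and the
-- link of every vertex is a single cycle (2-regularity of the link follows
-- from the edge condition; we require its connectedness).
record QuadEmbedding {n : ℕ} (G : SimpleGraph n) : Set where
  field
    faces     : List (Quad n)
    quadFaces : ∀ f → f ∈ faces → Is4Cycle G f
    edgeTwice : ∀ u v → Adj G u v → edgeOcc faces u v ≡ 2
    connected : Connected G
    linkConn  : ∀ v x y → Adj G v x → Adj G v y → Star (LinkEdge faces v) x y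
open QuadEmbedding public

orientFaces : ∀ {n} (fs : List (Quad n)) → (Fin (length fs) → Bool) → List (Quad n)
orientFaces fs o = tabulate (λ i → if o i then reverseQuad (lookup fs i) else lookup fs i)

Orientable : ∀ {n} {G : SimpleGraph n} → QuadEmbedding G → Set
Orientable {G = G} E =
  Σ (Fin (length (faces E)) → Bool) λ o →
    ∀ u v → Adj G u v → dirCount (orientFaces (faces E) o) u v ≡ 1

Nonorientable : ∀ {n} {G : SimpleGraph n} → QuadEmbedding G → Set
Nonorientable E = ¬ Orientable E

-- Euler characteristic V - E + F = 0 (as V + F = E)
EulerCharZero : ∀ {n} {G : SimpleGraph n} → QuadEmbedding G → Set
EulerCharZero {n} {G} E = n + length (faces E) ≡ edgeCount G

InKleinBottle : ∀ {n} {G : SimpleGraph n} → QuadEmbedding G → Set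
InKleinBottle E = Nonorientable E × EulerCharZero E

{-# OPTIONS --safe #-}
-- The divisibility condition and the bounds leave only (n , t) = (4 , 0) and (6 , 1),
-- and all three cases are realised by explicit quadrangulations: K₄ with 3 faces in the
-- projective plane, K₆ minus an edge with 7 faces in N₃, and K₆ minus a triangle with
-- 6 faces in the Klein bottle (6 − 12 + 6 = 0).  An embedding is given by its face list
-- and the graph is the skeleton of the faces.  Every condition on such a finite face list
-- is decided by evaluation; connectivity of the graph and of each vertex link is
-- certified by a walk through their vertices (for the links this is the rotation at the
-- vertex), and nonorientability by exhausting the 2^F ways of reversing faces.

module Submission where

open import Defs
open import Data.Nat using (ℕ; _≤_; _∸_)
open import Data.Nat.Combinatorics using (_C_)
open import Data.Integer using (+_; _-_; _*_)
open import Data.Integer.Divisibility using (_∣_)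
open import Data.Product using (_×_; ∃-syntax)
open import Relation.Binary.PropositionalEquality using (_≡_)
open import Relation.Nullary using (¬_)

open import Data.Bool using (Bool; true; if_then_else_)
import Data.Bool.Properties as Bool
open import Data.Nat using (suc; _<ᵇ_; s≤s)
import Data.Nat.Properties as ℕ
open import Data.Nat.Divisibility using (_∣?_)
open import Data.Fin using (Fin; _≟_)
open import Data.Fin.Patterns
open import Data.Fin.Properties using (all?)
open import Data.Fin.Subset.Properties using (anySubset?)
open import Data.List as List using (List; []; _∷_; length)
open import Data.List.Properties using (tabulate-cong)
open import Data.List.Relation.Unary.All as All using (All)
open import Data.List.Relation.Unary.Any using (here; there; any?)
open import Data.List.Relation.Unary.Linked using (Linked; [-]; _∷_; linked?)
open import Data.List.Membership.Propositional using (_∈_; find; lose)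
import Data.List.Membership.DecPropositional as DecMembership
import Data.Vec as Vec
open import Data.Vec.Properties using (lookup∘tabulate)
open import Data.Product using (_,_)
open import Data.Product.Properties using (≡-dec)
open import Data.Sum using (_⊎_; inj₁; inj₂)
open import Function using (_∘_)
open import Relation.Binary.Definitions using (Symmetric; Decidable)
open import Relation.Binary.PropositionalEquality using (refl; trans; cong; subst; _≗_)
import Relation.Binary.PropositionalEquality as ≡
open import Relation.Binary.Construct.Closure.ReflexiveTransitive using (Star; ε; _◅_; _◅◅_; reverse)
open import Relation.Nullary using (Dec; contradiction)
open import Relation.Nullary.Decidable
  using (map′; True; toWitness; from-yes; from-no; ¬?; _×-dec_; _⊎-dec_; _→-dec_)

linked⇒star : ∀ {A : Set} {R : A → A → Set} {xs : List A} {x y : A} →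
              Symmetric R → Linked R xs → x ∈ xs → y ∈ xs → Star R x y
linked⇒star {xs = []}        _     _ ()  _
linked⇒star {R = R} {_ ∷ _} R-sym l x∈ y∈ = reverse R-sym (fromHead l x∈) ◅◅ fromHead l y∈
  where
  fromHead : ∀ {z zs w} → Linked R (z ∷ zs) → w ∈ z ∷ zs → Star R z w
  fromHead _          (here refl) = ε
  fromHead [-]        (there ())
  fromHead (zRz′ ∷ l) (there w∈)  = zRz′ ◅ fromHead l w∈

module _ {n : ℕ} where

  open DecMembership (_≟_ {n}) using (_∈?_)
  open DecMembership (≡-dec (_≟_ {n}) (≡-dec (_≟_ {n}) (_≟_ {n}))) using () renaming (_∈?_ to _∈₃?_)

  skeleton : (fs : List (Quad n)) → (∀ v → edgeOcc fs v v ≡ 0) → SimpleGraph n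
  skeleton fs loopFree = record
    { adj      = λ u v → 0 <ᵇ edgeOcc fs u v
    ; sym      = λ u v → cong (0 <ᵇ_) (ℕ.+-comm (dirCount fs u v) (dirCount fs v u))
    ; loopless = λ v → cong (0 <ᵇ_) (loopFree v)
    }

  loopFree? : (fs : List (Quad n)) → Dec (∀ v → edgeOcc fs v v ≡ 0)
  loopFree? fs = all? λ v → edgeOcc fs v v ℕ.≟ 0

  adj? : (G : SimpleGraph n) → Decidable (Adj G)
  adj? G u v = adj G u v Bool.≟ true

  adj-sym : (G : SimpleGraph n) → Symmetric (Adj G)
  adj-sym G {u} {v} = trans (sym G v u)

  is4Cycle? : (G : SimpleGraph n) (f : Quad n) → Dec (Is4Cycle G f)
  is4Cycle? G (a , b , c , d) =
    ¬? (a ≟ b) ×-dec ¬? (a ≟ c) ×-dec ¬? (a ≟ d) ×-dec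
    ¬? (b ≟ c) ×-dec ¬? (b ≟ d) ×-dec ¬? (c ≟ d) ×-dec
    adj? G a b ×-dec adj? G b c ×-dec adj? G c d ×-dec adj? G d a

  linkEdge? : (fs : List (Quad n)) (v : Fin n) → Decidable (LinkEdge fs v)
  linkEdge? fs v x y = map′ find (λ (_ , f∈ , c) → lose f∈ c) (any? corner? fs)
    where
    corner? : ∀ f → Dec ((x , v , y) ∈ corners f ⊎ (y , v , x) ∈ corners f)
    corner? f = ((x , v , y) ∈₃? corners f) ⊎-dec ((y , v , x) ∈₃? corners f)

  linkEdge-sym : (fs : List (Quad n)) (v : Fin n) → Symmetric (LinkEdge fs v)
  linkEdge-sym fs v (f , f∈ , inj₁ c) = f , f∈ , inj₂ c
  linkEdge-sym fs v (f , f∈ , inj₂ c) = f , f∈ , inj₁ c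

  orientFaces-cong : ∀ (fs : List (Quad n)) {o o′} → o ≗ o′ → orientFaces fs o ≡ orientFaces fs o′
  orientFaces-cong fs o≗o′ = tabulate-cong λ i →
    cong (λ b → if b then reverseQuad (List.lookup fs i) else List.lookup fs i) (o≗o′ i)

  module _ (G : SimpleGraph n) (fs : List (Quad n)) where

    -- tour is a walk in G through all vertices; rotation v is a walk in the link of v
    -- through all neighbours of v, i.e. the rotation at v read off the faces.
    IsCertificate : List (Fin n) → (Fin n → List (Fin n)) → Set
    IsCertificate tour rotation =
      All (Is4Cycle G) fs ×
      (∀ u v → Adj G u v → edgeOcc fs u v ≡ 2) ×
      Linked (Adj G) tour × (∀ u → u ∈ tour) ×
      (∀ v → Linked (LinkEdge fs v) (rotation v)) ×
      (∀ v x → Adj G v x → x ∈ rotation v)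

    isCertificate? : ∀ tour rotation → Dec (IsCertificate tour rotation)
    isCertificate? tour rotation =
      All.all? (is4Cycle? G) fs ×-dec
      (all? λ u → all? λ v → adj? G u v →-dec edgeOcc fs u v ℕ.≟ 2) ×-dec
      linked? (adj? G) tour ×-dec (all? λ u → u ∈? tour) ×-dec
      (all? λ v → linked? (linkEdge? fs v) (rotation v)) ×-dec
      (all? λ v → all? λ x → adj? G v x →-dec x ∈? rotation v)

    certifiedEmbedding : ∀ tour rotation → {True (isCertificate? tour rotation)} → QuadEmbedding G
    certifiedEmbedding tour rotation {valid} with toWitness valid
    ... | quads , twice , tour-linked , tour-covers , rotation-linked , rotation-covers = record
      { faces     = fs
      ; quadFaces = λ _ → All.lookup quads
      ; edgeTwice = twice
      ; connected = λ u v → linked⇒star (adj-sym G) tour-linked (tour-covers u) (tour-covers v)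
      ; linkConn  = λ v x y vx vy →
          linked⇒star (linkEdge-sym fs v) (rotation-linked v) (rotation-covers v x vx) (rotation-covers v y vy)
      }

  module _ {G : SimpleGraph n} (E : QuadEmbedding G) where

    OrientedBy : (Fin (length (faces E)) → Bool) → Set
    OrientedBy o = ∀ u v → Adj G u v → dirCount (orientFaces (faces E) o) u v ≡ 1

    orientedBy? : ∀ o → Dec (OrientedBy o)
    orientedBy? o = all? λ u → all? λ v → adj? G u v →-dec dirCount (orientFaces (faces E) o) u v ℕ.≟ 1

    orientedBy-cong : ∀ {o o′} → o ≗ o′ → OrientedBy o → OrientedBy o′
    orientedBy-cong o≗o′ oriented u v uv =
      subst (λ gs → dirCount gs u v ≡ 1) (orientFaces-cong (faces E) o≗o′) (oriented u v uv)

    orientable? : Dec (Orientable E)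
    orientable? =
      map′ (λ (os , oriented) → Vec.lookup os , oriented)
           (λ (o , oriented) → Vec.tabulate o , orientedBy-cong (≡.sym ∘ lookup∘tabulate o) oriented)
           (anySubset? (orientedBy? ∘ Vec.lookup))

K₄-faces : List (Quad 4)
K₄-faces = (3F , 2F , 1F , 0F) ∷ (1F , 3F , 2F , 0F) ∷ (2F , 0F , 3F , 1F) ∷ []

K₄ : SimpleGraph 4
K₄ = skeleton K₄-faces (from-yes (loopFree? K₄-faces))

K₄-rotation : Fin 4 → List (Fin 4)
K₄-rotation 0F = 1F ∷ 3F ∷ 2F ∷ []
K₄-rotation 1F = 0F ∷ 2F ∷ 3F ∷ []
K₄-rotation 2F = 0F ∷ 3F ∷ 1F ∷ []
K₄-rotation 3F = 0F ∷ 2F ∷ 1F ∷ []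

K₄-embedding : QuadEmbedding K₄
K₄-embedding = certifiedEmbedding K₄ K₄-faces (0F ∷ 1F ∷ 2F ∷ 3F ∷ []) K₄-rotation

K₄-embedding-nonorientable : Nonorientable K₄-embedding
K₄-embedding-nonorientable = from-no (orientable? K₄-embedding)

K₆-minus-edge-faces : List (Quad 6)
K₆-minus-edge-faces =
  (1F , 3F , 5F , 2F) ∷ (3F , 0F , 5F , 1F) ∷ (0F , 5F , 2F , 4F) ∷ (2F , 0F , 1F , 4F) ∷
  (5F , 3F , 4F , 1F) ∷ (1F , 2F , 3F , 0F) ∷ (2F , 0F , 4F , 3F) ∷ []

K₆-minus-edge : SimpleGraph 6
K₆-minus-edge = skeleton K₆-minus-edge-faces (from-yes (loopFree? K₆-minus-edge-faces))

K₆-minus-edge-rotation : Fin 6 → List (Fin 6)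
K₆-minus-edge-rotation 0F = 1F ∷ 2F ∷ 4F ∷ 5F ∷ 3F ∷ []
K₆-minus-edge-rotation 1F = 0F ∷ 4F ∷ 5F ∷ 3F ∷ 2F ∷ []
K₆-minus-edge-rotation 2F = 0F ∷ 4F ∷ 5F ∷ 1F ∷ 3F ∷ []
K₆-minus-edge-rotation 3F = 0F ∷ 1F ∷ 5F ∷ 4F ∷ 2F ∷ []
K₆-minus-edge-rotation 4F = 0F ∷ 2F ∷ 1F ∷ 3F ∷ []
K₆-minus-edge-rotation 5F = 0F ∷ 1F ∷ 3F ∷ 2F ∷ []

K₆-minus-edge-embedding : QuadEmbedding K₆-minus-edge
K₆-minus-edge-embedding =
  certifiedEmbedding K₆-minus-edge K₆-minus-edge-faces
    (4F ∷ 0F ∷ 5F ∷ 1F ∷ 2F ∷ 3F ∷ []) K₆-minus-edge-rotation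

K₆-minus-edge-embedding-nonorientable : Nonorientable K₆-minus-edge-embedding
K₆-minus-edge-embedding-nonorientable = from-no (orientable? K₆-minus-edge-embedding)

K₆-minus-triangle-faces : List (Quad 6)
K₆-minus-triangle-faces =
  (3F , 1F , 4F , 5F) ∷ (3F , 0F , 5F , 1F) ∷ (0F , 3F , 2F , 4F) ∷
  (1F , 4F , 2F , 5F) ∷ (0F , 5F , 3F , 4F) ∷ (4F , 3F , 2F , 5F) ∷ []

K₆-minus-triangle : SimpleGraph 6
K₆-minus-triangle = skeleton K₆-minus-triangle-faces (from-yes (loopFree? K₆-minus-triangle-faces))

K₆-minus-triangle-rotation : Fin 6 → List (Fin 6)
K₆-minus-triangle-rotation 0F = 3F ∷ 5F ∷ 4F ∷ []
K₆-minus-triangle-rotation 1F = 3F ∷ 4F ∷ 5F ∷ []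
K₆-minus-triangle-rotation 2F = 3F ∷ 4F ∷ 5F ∷ []
K₆-minus-triangle-rotation 3F = 0F ∷ 1F ∷ 5F ∷ 4F ∷ 2F ∷ []
K₆-minus-triangle-rotation 4F = 0F ∷ 2F ∷ 1F ∷ 5F ∷ 3F ∷ []
K₆-minus-triangle-rotation 5F = 0F ∷ 1F ∷ 2F ∷ 4F ∷ 3F ∷ []

K₆-minus-triangle-embedding : QuadEmbedding K₆-minus-triangle
K₆-minus-triangle-embedding =
  certifiedEmbedding K₆-minus-triangle K₆-minus-triangle-faces
    (0F ∷ 3F ∷ 1F ∷ 4F ∷ 2F ∷ 5F ∷ []) K₆-minus-triangle-rotation

K₆-minus-triangle-embedding-inKleinBottle : InKleinBottle K₆-minus-triangle-embedding
K₆-minus-triangle-embedding-inKleinBottle = from-no (orientable? K₆-minus-triangle-embedding) , refl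

admissible-parameters : (n t : ℕ) → 4 ≤ n → n ≤ 6 → t ≤ n ∸ 4 →
                        (+ 4) ∣ ((+ 2) * (+ t) - (+ n) * ((+ n) - (+ 5))) →
                        ¬ (n ≡ 5 × t ≡ 0) →
                        (n ≡ 4 × t ≡ 0) ⊎ (n ≡ 6 × t ≡ 1)
admissible-parameters 4 0 _ _ _ _ _       = inj₁ (refl , refl)
admissible-parameters 5 0 _ _ _ _ ¬5,0    = contradiction (refl , refl) ¬5,0
admissible-parameters 5 1 _ _ _ 4∣2 _     = contradiction 4∣2 (from-no (4 ∣? 2))
admissible-parameters 6 0 _ _ _ 4∣6 _     = contradiction 4∣6 (from-no (4 ∣? 6))
admissible-parameters 6 1 _ _ _ _ _       = inj₂ (refl , refl)
admissible-parameters 6 2 _ _ _ 4∣2 _     = contradiction 4∣2 (from-no (4 ∣? 2))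
admissible-parameters 4 (suc _) _ _ () _ _
admissible-parameters 5 (suc (suc _)) _ _ (s≤s ()) _ _
admissible-parameters 6 (suc (suc (suc _))) _ _ (s≤s (s≤s ())) _ _
admissible-parameters (suc (suc (suc (suc (suc (suc (suc _))))))) _ _ (s≤s (s≤s (s≤s (s≤s (s≤s (s≤s ())))))) _ _
admissible-parameters 0 _ () _ _ _ _
admissible-parameters 1 _ (s≤s ()) _ _ _ _
admissible-parameters 2 _ (s≤s (s≤s ())) _ _ _ _
admissible-parameters 3 _ (s≤s (s≤s (s≤s ()))) _ _ _ _

lemma4p3 :
    ((n t : ℕ) → 4 ≤ n → n ≤ 6 → t ≤ n ∸ 4 →
      (+ 4) ∣ ((+ 2) * (+ t) - (+ n) * ((+ n) - (+ 5))) →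
      ¬ (n ≡ 5 × t ≡ 0) →
      ∃[ G ] (edgeCount {n} G ≡ n C 2 ∸ t × ∃[ E ] Nonorientable {n} {G} E))
    ×
    (∃[ G ] (edgeCount {6} G ≡ 6 C 2 ∸ 3 × ∃[ E ] InKleinBottle {6} {G} E))
lemma4p3 =
  (λ n t 4≤n n≤6 t≤n∸4 4∣ ¬5,0 → realise (admissible-parameters n t 4≤n n≤6 t≤n∸4 4∣ ¬5,0)) ,
  (K₆-minus-triangle , refl , K₆-minus-triangle-embedding , K₆-minus-triangle-embedding-inKleinBottle)
  where
  realise : ∀ {n t} → (n ≡ 4 × t ≡ 0) ⊎ (n ≡ 6 × t ≡ 1) →
            ∃[ G ] (edgeCount {n} G ≡ n C 2 ∸ t × ∃[ E ] Nonorientable {n} {G} E)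
  realise (inj₁ (refl , refl)) = K₄ , refl , K₄-embedding , K₄-embedding-nonorientable
  realise (inj₂ (refl , refl)) = K₆-minus-edge , refl , K₆-minus-edge-embedding , K₆-minus-edge-embedding-nonorientable
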